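{- Let $G$ be a finite group and let $\pi=\{C_1,\dots,C_\ell\}$ be a collection of $\ell$ distinct subsets of $G$, each of size $k$ and containing the identity $e$, such that any two distinct cells intersect exactly in $\{e\}$ and $\pi$ satisfies the $T$-axiom. Let $N$ be the biadjacency matrix of the Cayley incidence graph $\mathrm{BCay}(G,\pi)$ (rows indexed by $\gamma=G$, columns by $\beta$), and let $A$ be the adjacency matrix of the underlying Cayley graph $\mathrm{Cay}(G,S(\pi))$. Then $NN^T=A+\ell I$.
   Context: For $C\subseteq G$ and $g\in G$, $gC=\{gs:s\in C\}$. A collection $\pi$ of subsets of $G$, each containing $e$, satisfies the $T$-axiom if for every $C\in\pi$ and every $s\in C$ we have $s^{ -1}C\in\pi$. The Cayley incidence graph $\mathrm{BCay}(G,\pi)$ is the bipartite graph with parts $\gamma=G$ and $\beta=\{gC:g\in G,C\in\pi\}$ (a set of subsets of $G$, so equal translates give one vertex), with an edge between $g$ and $gC$ for every $g\in G$, $C\in\pi$; equivalently $g\in\gamma$ is adjacent to $D\in\beta$ iff $g\in D$. The biadjacency matrix $N$ is the $\gamma\times\beta$ 0/1 matrix with entry $1$ iff the two vertices are adjacent. $S(\pi)=\bigcup_{i=1}^{\ell}C_i\setminus\{e\}$, and $\mathrm{Cay}(G,S)$ is the graph on $G$ with $g\sim h$ iff $h^{ -1}g\in S$. -}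

module Defs where

open import Level using (0ℓ)
open import Data.Nat using (ℕ; _+_; _*_)
open import Data.Bool using (Bool)
import Data.Bool.Properties as BoolP
open import Data.Fin using (Fin)
open import Data.Fin.Subset using (Subset; _∈_; ⋃; _-_)
open import Data.Fin.Subset.Properties using (_∈?_)
open import Data.Vec using (Vec; tabulate; lookup)
import Data.Vec.Properties as VecP
open import Data.Nat.ListAction using (sum)
open import Data.List using (List; map; allFin; length; concatMap; deduplicate)
import Data.List as L
open import Data.Product using (Σ; _×_; _,_)
open import Relation.Binary.PropositionalEquality using (_≡_)
open import Relation.Binary.Definitions using (DecidableEquality)
open import Relation.Nullary using (Dec; yes; no)
open import Algebra.Structures using (IsGroup)
open import Data.Fin.Properties using (_≟_)

-- A finite group, presented (up to isomorphism) on the carrier Fin order,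
-- with propositional equality and the stdlib's group axioms.
record FinGroup : Set where
  field
    order : ℕ
    _∙_   : Fin order → Fin order → Fin order
    e     : Fin order
    _⁻¹   : Fin order → Fin order
    isGroup : IsGroup _≡_ _∙_ e _⁻¹

module _ (G : FinGroup) where
  open FinGroup G

  Elt : Set
  Elt = Fin order

  -- left translate g C = { g s : s ∈ C }  (x ∈ gC iff g⁻¹ x ∈ C)
  translate : Elt → Subset order → Subset order
  translate g C = tabulate (λ x → lookup C ((g ⁻¹) ∙ x))

  subset≟ : DecidableEquality (Subset order)
  subset≟ = VecP.≡-dec BoolP._≟_

  [_] : ∀ {p} {P : Set p} → Dec P → ℕ
  [ yes _ ] = 1
  [ no _ ]  = 0

  I : Elt → Elt → ℕ
  I g h = [ g ≟ h ]

  module _ {ℓ : ℕ} (π : Fin ℓ → Subset order) where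

    β : List (Subset order)
    β = deduplicate subset≟
          (concatMap (λ g → map (λ i → translate g (π i)) (allFin ℓ)) (allFin order))

    N : Elt → Fin (length β) → ℕ
    N g c = [ g ∈? L.lookup β c ]

    NNᵀ : Elt → Elt → ℕ
    NNᵀ g h = sum (map (λ c → N g c * N h c) (allFin (length β)))

    S : Subset order
    S = ⋃ (map π (allFin ℓ)) - e

    A : Elt → Elt → ℕ
    A g h = [ ((h ⁻¹) ∙ g) ∈? S ]

-- By the T-axiom every
-- block x C through g is a translate g C′ of a cell (g = x s with s ∈ C, and x C = g (s⁻¹ C)),
-- and distinct cells give distinct translates, so the blocks through g are exactly
-- g C₁, …, g C_ℓ. Hence (N Nᵀ)(g,h) counts the cells containing g⁻¹ h: all ℓ of them when
-- g = h, and otherwise at most one (distinct cells meet only in e), namely exactly when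
-- g⁻¹ h ∈ ⋃ Cᵢ. The T-axiom also makes ⋃ Cᵢ closed under inverses, so this is the
-- condition h⁻¹ g ∈ S(π) defining the Cayley graph.
module Submission where

open import Defs
open import Data.Nat using (ℕ; _+_; _*_)
open import Data.Fin using (Fin)
open import Data.Fin.Subset using (Subset; _∈_; _∩_; ⁅_⁆; ∣_∣)
open import Data.Product using (Σ)
open import Relation.Binary.PropositionalEquality using (_≡_; _≢_)
open import Function.Definitions using (Injective)

open import Level using (0ℓ)
open import Algebra.Bundles using (Group)
import Algebra.Properties.Group as GroupProperties
open import Data.Empty using (⊥-elim)
open import Data.Fin.Properties using (_≟_)
open import Data.Fin.Subset using (_∉_; _─_; ⋃; outside)
open import Data.Fin.Subset.Properties
  using (_∈?_; ∉⊥; x∈p∪q⁺; x∈p∪q⁻; x∈p∩q⁺; x∈⁅x⁆; x∈⁅y⁆⇒x≡y; x∈p∧x∉q⇒x∈p─q; p─q⊆p)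
open import Data.List using (List; []; _∷_; map; filter; allFin; length; concatMap)
import Data.List as List
open import Data.List.Properties using (map-∘; map-cong; map-tabulate; tabulate-lookup; length-tabulate)
open import Data.List.Membership.Propositional using (find; lose) renaming (_∈_ to _∈ₗ_)
open import Data.List.Membership.Propositional.Properties
  using (∈-allFin; ∈-map⁺; ∈-map⁻; ∈-concatMap⁺; ∈-concatMap⁻; ∈-filter⁺; ∈-filter⁻;
         ∈-deduplicate⁺; ∈-deduplicate⁻)
open import Data.List.Membership.Propositional.Properties.WithK using (unique∧set⇒bag)
open import Data.List.Relation.Binary.BagAndSetEquality using (_∼[_]_; bag; ∼bag⇒↭)
open import Data.List.Relation.Binary.Permutation.Propositional.Properties using () renaming (map⁺ to ↭-map⁺)
open import Data.List.Relation.Unary.Any using (Any; here; there)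
import Data.List.Relation.Unary.All as All
open import Data.List.Relation.Unary.AllPairs as AllPairs using (AllPairs; []; _∷_)
import Data.List.Relation.Unary.AllPairs.Properties as AllPairs
open import Data.List.Relation.Unary.Unique.Propositional using (Unique)
import Data.List.Relation.Unary.Unique.Propositional.Properties as Unique
open import Data.List.Relation.Unary.Unique.DecPropositional.Properties using (deduplicate-!)
open import Data.Nat.ListAction using (sum)
open import Data.Nat.ListAction.Properties using (sum-↭)
import Data.Nat.Properties as ℕ
open import Data.Product using (_,_; ∃; ∃₂)
open import Data.Sum using (inj₁; inj₂; [_,_]′)
open import Data.Vec using (_∷_; lookup; here; there)
import Data.Vec.Properties as Vec
open import Function using (_∘_; id; _⇔_; mk⇔; Equivalence)
open import Relation.Binary.PropositionalEquality using (refl; sym; trans; cong; cong₂; subst; module ≡-Reasoning)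
open import Relation.Nullary using (Dec; yes; no; ¬_)
open import Relation.Unary using (Pred; Decidable)

open ≡-Reasoning

module _ {A : Set} where

  sum-map-lookup : (f : A → ℕ) (xs : List A) →
                   sum (map (f ∘ List.lookup xs) (allFin (length xs))) ≡ sum (map f xs)
  sum-map-lookup f xs = cong sum (begin
    map (f ∘ List.lookup xs) (allFin (length xs))       ≡⟨ map-∘ (allFin (length xs)) ⟩
    map f (map (List.lookup xs) (allFin (length xs)))   ≡⟨ cong (map f) (map-tabulate _ (List.lookup xs)) ⟩
    map f (List.tabulate (List.lookup xs))              ≡⟨ cong (map f) (tabulate-lookup xs) ⟩
    map f xs                                            ∎)

  sum-map-filter : {P : Pred A 0ℓ} (P? : Decidable P) (f : A → ℕ) → (∀ x → ¬ P x → f x ≡ 0) →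
                   ∀ xs → sum (map f (filter P? xs)) ≡ sum (map f xs)
  sum-map-filter P? f f-vanishes [] = refl
  sum-map-filter P? f f-vanishes (x ∷ xs) with P? x
  ... | yes _  = cong (f x +_) (sum-map-filter P? f f-vanishes xs)
  ... | no ¬px = trans (sum-map-filter P? f f-vanishes xs) (cong (_+ sum (map f xs)) (sym (f-vanishes x ¬px)))

  sum-map-≡1 : (f : A → ℕ) → (∀ x → f x ≡ 1) → ∀ xs → sum (map f xs) ≡ length xs
  sum-map-≡1 f f≡1 []       = refl
  sum-map-≡1 f f≡1 (x ∷ xs) = cong₂ _+_ (f≡1 x) (sum-map-≡1 f f≡1 xs)

x∈p─q⇒x∉q : ∀ {n} {x : Fin n} (p q : Subset n) → x ∈ p ─ q → x ∉ q
x∈p─q⇒x∉q (_ ∷ p) (outside ∷ q) here ()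
x∈p─q⇒x∉q (_ ∷ p) (_ ∷ q) (there x∈p─q) (there x∈q) = x∈p─q⇒x∉q p q x∈p─q x∈q

module _ {n : ℕ} where

  x∈⋃⁺ : ∀ {x : Fin n} {ps : List (Subset n)} → Any (x ∈_) ps → x ∈ ⋃ ps
  x∈⋃⁺ (here x∈p)   = x∈p∪q⁺ (inj₁ x∈p)
  x∈⋃⁺ (there x∈ps) = x∈p∪q⁺ (inj₂ (x∈⋃⁺ x∈ps))

  x∈⋃⁻ : ∀ {x : Fin n} (ps : List (Subset n)) → x ∈ ⋃ ps → Any (x ∈_) ps
  x∈⋃⁻ []       x∈⊥ = ⊥-elim (∉⊥ x∈⊥)
  x∈⋃⁻ (p ∷ ps) x∈⋃ with x∈p∪q⁻ p (⋃ ps) x∈⋃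
  ... | inj₁ x∈p  = here x∈p
  ... | inj₂ x∈ps = there (x∈⋃⁻ ps x∈ps)

module _ (G : FinGroup) where
  open FinGroup G

  group : Group 0ℓ 0ℓ
  group = record { isGroup = isGroup }

  open Group group using (assoc; identityˡ; inverseˡ; inverseʳ)
  open GroupProperties group using (ε⁻¹≈ε; ⁻¹-involutive; ⁻¹-injective; ⁻¹-anti-homo-∙; inverseˡ-unique)

  private
    𝟙 : ∀ {p} {P : Set p} → Dec P → ℕ
    𝟙 = [_] G

  𝟙-yes : ∀ {p} {P : Set p} → P → (d : Dec P) → 𝟙 d ≡ 1
  𝟙-yes p (yes _) = refl
  𝟙-yes p (no ¬p) = ⊥-elim (¬p p)

  𝟙-no : ∀ {p} {P : Set p} → ¬ P → (d : Dec P) → 𝟙 d ≡ 0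
  𝟙-no ¬p (yes p) = ⊥-elim (¬p p)
  𝟙-no ¬p (no _)  = refl

  𝟙-cong : ∀ {p q} {P : Set p} {Q : Set q} → P ⇔ Q → (d : Dec P) (d′ : Dec Q) → 𝟙 d ≡ 𝟙 d′
  𝟙-cong P⇔Q (yes p) d′ = sym (𝟙-yes (Equivalence.to P⇔Q p) d′)
  𝟙-cong P⇔Q (no ¬p) d′ = sym (𝟙-no (¬p ∘ Equivalence.from P⇔Q) d′)

  sum-𝟙-⋃ : ∀ {x : Elt G} {ps : List (Subset order)} → AllPairs (λ p q → x ∈ p → x ∉ q) ps →
            sum (map (λ p → 𝟙 (x ∈? p)) ps) ≡ 𝟙 (x ∈? ⋃ ps)
  sum-𝟙-⋃ {x} {[]}     []                = sym (𝟙-no ∉⊥ (x ∈? ⋃ []))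
  sum-𝟙-⋃ {x} {p ∷ ps} (p-excl ∷ ps-excl) with x ∈? p
  ... | yes x∈p = begin
    1 + sum (map (λ q → 𝟙 (x ∈? q)) ps)   ≡⟨ cong (1 +_) (sum-𝟙-⋃ ps-excl) ⟩
    1 + 𝟙 (x ∈? ⋃ ps)                     ≡⟨ cong (1 +_) (𝟙-no (x∉⋃ps ∘ x∈⋃⁻ ps) (x ∈? ⋃ ps)) ⟩
    1                                     ≡⟨ sym (𝟙-yes (x∈p∪q⁺ (inj₁ x∈p)) (x ∈? ⋃ (p ∷ ps))) ⟩
    𝟙 (x ∈? ⋃ (p ∷ ps))                   ∎
    where
    x∉⋃ps : ¬ Any (x ∈_) ps
    x∉⋃ps x∈ps = let _ , q∈ps , x∈q = find x∈ps in All.lookup p-excl q∈ps x∈p x∈q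
  ... | no x∉p = trans (sum-𝟙-⋃ ps-excl) (𝟙-cong ⋃ps⇔⋃p∷ps (x ∈? ⋃ ps) (x ∈? ⋃ (p ∷ ps)))
    where
    ⋃ps⇔⋃p∷ps : x ∈ ⋃ ps ⇔ x ∈ ⋃ (p ∷ ps)
    ⋃ps⇔⋃p∷ps = mk⇔ (x∈p∪q⁺ ∘ inj₂) ([ ⊥-elim ∘ x∉p , id ]′ ∘ x∈p∪q⁻ p (⋃ ps))

  ⁻¹∙-≡ε⇒≡ : ∀ g h → (g ⁻¹) ∙ h ≡ e → g ≡ h
  ⁻¹∙-≡ε⇒≡ g h eq = ⁻¹-injective (inverseˡ-unique (g ⁻¹) h eq)

  ⁻¹∙-⁻¹ : ∀ g h → ((g ⁻¹) ∙ h) ⁻¹ ≡ (h ⁻¹) ∙ g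
  ⁻¹∙-⁻¹ g h = trans (⁻¹-anti-homo-∙ (g ⁻¹) h) (cong ((h ⁻¹) ∙_) (⁻¹-involutive g))

  ∙[⁻¹∙]⁻¹ : ∀ x g → g ∙ (((x ⁻¹) ∙ g) ⁻¹) ≡ x
  ∙[⁻¹∙]⁻¹ x g = begin
    g ∙ (((x ⁻¹) ∙ g) ⁻¹)   ≡⟨ cong (g ∙_) (⁻¹∙-⁻¹ x g) ⟩
    g ∙ ((g ⁻¹) ∙ x)        ≡⟨ sym (assoc g (g ⁻¹) x) ⟩
    (g ∙ (g ⁻¹)) ∙ x        ≡⟨ cong (_∙ x) (inverseʳ g) ⟩
    e ∙ x                   ≡⟨ identityˡ x ⟩
    x                       ∎

  lookup-translate : ∀ g C y → lookup (translate G g C) y ≡ lookup C ((g ⁻¹) ∙ y)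
  lookup-translate g C y = Vec.lookup∘tabulate _ y

  ∈-translate⁺ : ∀ {g C y} → (g ⁻¹) ∙ y ∈ C → y ∈ translate G g C
  ∈-translate⁺ {g} {C} {y} m =
    Vec.lookup⇒[]= y _ (trans (lookup-translate g C y) (Vec.[]=⇒lookup m))

  ∈-translate⁻ : ∀ {g C y} → y ∈ translate G g C → (g ⁻¹) ∙ y ∈ C
  ∈-translate⁻ {g} {C} {y} m =
    Vec.lookup⇒[]= _ C (trans (sym (lookup-translate g C y)) (Vec.[]=⇒lookup m))

  ∈-translate-self : ∀ {g C} → e ∈ C → g ∈ translate G g C
  ∈-translate-self {g} e∈C = ∈-translate⁺ (subst (_∈ _) (sym (inverseˡ g)) e∈C)

  translate-∙ : ∀ g h C → translate G g (translate G h C) ≡ translate G (g ∙ h) C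
  translate-∙ g h C = Vec.tabulate-cong λ y → begin
    lookup (translate G h C) ((g ⁻¹) ∙ y)   ≡⟨ lookup-translate h C _ ⟩
    lookup C ((h ⁻¹) ∙ ((g ⁻¹) ∙ y))        ≡⟨ cong (lookup C) (sym (assoc (h ⁻¹) (g ⁻¹) y)) ⟩
    lookup C (((h ⁻¹) ∙ (g ⁻¹)) ∙ y)        ≡⟨ cong (λ z → lookup C (z ∙ y)) (sym (⁻¹-anti-homo-∙ g h)) ⟩
    lookup C (((g ∙ h) ⁻¹) ∙ y)             ∎

  translate-identity : ∀ C → translate G e C ≡ C
  translate-identity C = trans (Vec.tabulate-cong λ y → cong (lookup C) e⁻¹∙y≡y) (Vec.tabulate∘lookup C)
    where
    e⁻¹∙y≡y : ∀ {y} → (e ⁻¹) ∙ y ≡ y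
    e⁻¹∙y≡y {y} = trans (cong (_∙ y) ε⁻¹≈ε) (identityˡ y)

  translate-injective : ∀ g {C D} → translate G g C ≡ translate G g D → C ≡ D
  translate-injective g {C} {D} eq = begin
    C                                       ≡⟨ sym (untranslate C) ⟩
    translate G (g ⁻¹) (translate G g C)    ≡⟨ cong (translate G (g ⁻¹)) eq ⟩
    translate G (g ⁻¹) (translate G g D)    ≡⟨ untranslate D ⟩
    D                                       ∎
    where
    untranslate : ∀ C → translate G (g ⁻¹) (translate G g C) ≡ C
    untranslate C = trans (translate-∙ (g ⁻¹) g C)
                          (trans (cong (λ z → translate G z C) (inverseˡ g)) (translate-identity C))

  module _ {ℓ : ℕ} (π : Fin ℓ → Subset order) where

    TAxiom : Set
    TAxiom = ∀ i s → s ∈ π i → Σ (Fin ℓ) λ j → translate G (s ⁻¹) (π i) ≡ π j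

    ⋃π : Subset order
    ⋃π = ⋃ (map π (allFin ℓ))

    blocksAt : Elt G → List (Subset order)
    blocksAt g = map (λ i → translate G g (π i)) (allFin ℓ)

    ∈-⋃π⁺ : ∀ {x} i → x ∈ π i → x ∈ ⋃π
    ∈-⋃π⁺ i x∈πi = x∈⋃⁺ (lose (∈-map⁺ π (∈-allFin i)) x∈πi)

    ∈-⋃π⁻ : ∀ {x} → x ∈ ⋃π → ∃ λ i → x ∈ π i
    ∈-⋃π⁻ x∈⋃π with find (x∈⋃⁻ (map π (allFin ℓ)) x∈⋃π)
    ... | _ , C∈π , x∈C with ∈-map⁻ π C∈π
    ... | i , _ , refl = i , x∈C

    ⋃π-⁻¹-closed : TAxiom → (∀ i → e ∈ π i) → ∀ {x} → x ∈ ⋃π → x ⁻¹ ∈ ⋃π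
    ⋃π-⁻¹-closed T e∈π x∈⋃π with ∈-⋃π⁻ x∈⋃π
    ... | i , x∈πi with T i _ x∈πi
    ... | j , eq = ∈-⋃π⁺ j (subst (_ ∈_) eq (∈-translate-self (e∈π i)))

    block-through : TAxiom → ∀ {x g} i → g ∈ translate G x (π i) →
                    ∃ λ j → translate G x (π i) ≡ translate G g (π j)
    block-through T {x} {g} i g∈xπi with T i ((x ⁻¹) ∙ g) (∈-translate⁻ g∈xπi)
    ... | j , eq = j , (begin
      translate G x (π i)                                  ≡⟨ cong (λ z → translate G z (π i)) (sym (∙[⁻¹∙]⁻¹ x g)) ⟩
      translate G (g ∙ (((x ⁻¹) ∙ g) ⁻¹)) (π i)            ≡⟨ sym (translate-∙ g _ (π i)) ⟩
      translate G g (translate G (((x ⁻¹) ∙ g) ⁻¹) (π i))  ≡⟨ cong (translate G g) eq ⟩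
      translate G g (π j)                                  ∎)

    ∈-β⁺ : ∀ x i → translate G x (π i) ∈ₗ β G π
    ∈-β⁺ x i = ∈-deduplicate⁺ (subset≟ G) (∈-concatMap⁺ blocksAt (lose (∈-allFin x) (∈-map⁺ _ (∈-allFin i))))

    ∈-β⁻ : ∀ {D} → D ∈ₗ β G π → ∃₂ λ x i → D ≡ translate G x (π i)
    ∈-β⁻ D∈β with find (∈-concatMap⁻ blocksAt {xs = allFin order} (∈-deduplicate⁻ (subset≟ G) _ D∈β))
    ... | x , _ , D∈blocks with ∈-map⁻ _ D∈blocks
    ... | i , _ , eq = x , i , eq

    blocksAt-unique : Injective _≡_ _≡_ π → ∀ g → Unique (blocksAt g)
    blocksAt-unique π-injective g =
      Unique.map⁺ (π-injective ∘ translate-injective g) (Unique.allFin⁺ ℓ)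

    ∈-β-through⇔∈-blocksAt : TAxiom → (∀ i → e ∈ π i) →
                             ∀ g {D} → D ∈ₗ filter (g ∈?_) (β G π) ⇔ D ∈ₗ blocksAt g
    ∈-β-through⇔∈-blocksAt T e∈π g = mk⇔ to from
      where
      to : ∀ {D} → D ∈ₗ filter (g ∈?_) (β G π) → D ∈ₗ blocksAt g
      to D∈ with ∈-filter⁻ (g ∈?_) D∈
      ... | D∈β , g∈D with ∈-β⁻ D∈β
      ... | x , i , refl with block-through T i g∈D
      ... | j , eq = subst (_∈ₗ blocksAt g) (sym eq) (∈-map⁺ _ (∈-allFin j))
      from : ∀ {D} → D ∈ₗ blocksAt g → D ∈ₗ filter (g ∈?_) (β G π)
      from D∈ with ∈-map⁻ _ D∈
      ... | i , _ , refl = ∈-filter⁺ (g ∈?_) (∈-β⁺ g i) (∈-translate-self (e∈π i))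

    NNᵀ≡sum-cells : Injective _≡_ _≡_ π → (∀ i → e ∈ π i) → TAxiom →
                    ∀ g h → NNᵀ G π g h ≡ sum (map (λ i → 𝟙 ((g ⁻¹) ∙ h ∈? π i)) (allFin ℓ))
    NNᵀ≡sum-cells π-injective e∈π T g h = begin
      NNᵀ G π g h                              ≡⟨ sum-map-lookup f (β G π) ⟩
      sum (map f (β G π))                      ≡⟨ sym (sum-map-filter (g ∈?_) f f-vanishes (β G π)) ⟩
      sum (map f (filter (g ∈?_) (β G π)))     ≡⟨ sum-↭ (↭-map⁺ f (∼bag⇒↭ filter-β↔blocksAt)) ⟩
      sum (map f (blocksAt g))                 ≡⟨ cong sum (sym (map-∘ (allFin ℓ))) ⟩
      sum (map (f ∘ translate G g ∘ π) (allFin ℓ))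
        ≡⟨ cong sum (map-cong f-translate (allFin ℓ)) ⟩
      sum (map (λ i → 𝟙 ((g ⁻¹) ∙ h ∈? π i)) (allFin ℓ)) ∎
      where
      f : Subset order → ℕ
      f D = 𝟙 (g ∈? D) * 𝟙 (h ∈? D)
      f-vanishes : ∀ D → g ∉ D → f D ≡ 0
      f-vanishes D g∉D = cong (_* 𝟙 (h ∈? D)) (𝟙-no g∉D (g ∈? D))
      filter-β↔blocksAt : filter (g ∈?_) (β G π) ∼[ bag ] blocksAt g
      filter-β↔blocksAt = unique∧set⇒bag
        (Unique.filter⁺ (g ∈?_) (deduplicate-! (subset≟ G) (concatMap blocksAt (allFin order))))
        (blocksAt-unique π-injective g)
        (∈-β-through⇔∈-blocksAt T e∈π g)
      f-translate : ∀ i → f (translate G g (π i)) ≡ 𝟙 ((g ⁻¹) ∙ h ∈? π i)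
      f-translate i = begin
        𝟙 (g ∈? translate G g (π i)) * 𝟙 (h ∈? translate G g (π i))
          ≡⟨ cong (_* 𝟙 (h ∈? translate G g (π i))) (𝟙-yes (∈-translate-self (e∈π i)) (g ∈? translate G g (π i))) ⟩
        1 * 𝟙 (h ∈? translate G g (π i))
          ≡⟨ ℕ.*-identityˡ _ ⟩
        𝟙 (h ∈? translate G g (π i))
          ≡⟨ 𝟙-cong (mk⇔ (∈-translate⁻ {g} {π i}) ∈-translate⁺) _ _ ⟩
        𝟙 ((g ⁻¹) ∙ h ∈? π i) ∎

    sum-cells-at-non-identity : (∀ i j → i ≢ j → π i ∩ π j ≡ ⁅ e ⁆) → ∀ {x} → x ≢ e →
                                sum (map (λ i → 𝟙 (x ∈? π i)) (allFin ℓ)) ≡ 𝟙 (x ∈? ⋃π)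
    sum-cells-at-non-identity π-meet {x} x≢e = begin
      sum (map (λ i → 𝟙 (x ∈? π i)) (allFin ℓ))      ≡⟨ cong sum (map-∘ (allFin ℓ)) ⟩
      sum (map (λ p → 𝟙 (x ∈? p)) (map π (allFin ℓ))) ≡⟨ sum-𝟙-⋃ (AllPairs.map⁺ (AllPairs.map exclusive (Unique.allFin⁺ ℓ))) ⟩
      𝟙 (x ∈? ⋃π)                                     ∎
      where
      exclusive : ∀ {i j} → i ≢ j → x ∈ π i → x ∉ π j
      exclusive i≢j x∈πi x∈πj = x≢e (x∈⁅y⁆⇒x≡y e (subst (x ∈_) (π-meet _ _ i≢j) (x∈p∩q⁺ (x∈πi , x∈πj))))

    sum-cells-at-identity : (∀ i → e ∈ π i) → sum (map (λ i → 𝟙 (e ∈? π i)) (allFin ℓ)) ≡ ℓ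
    sum-cells-at-identity e∈π =
      trans (sum-map-≡1 _ (λ i → 𝟙-yes (e∈π i) _) (allFin ℓ)) (length-tabulate (λ i → i))

    quotient-∈-⋃π⇔∈-S : TAxiom → (∀ i → e ∈ π i) → ∀ {g h} → g ≢ h →
                        (g ⁻¹) ∙ h ∈ ⋃π ⇔ (h ⁻¹) ∙ g ∈ S G π
    quotient-∈-⋃π⇔∈-S T e∈π {g} {h} g≢h = mk⇔ to from
      where
      to : (g ⁻¹) ∙ h ∈ ⋃π → (h ⁻¹) ∙ g ∈ S G π
      to x∈⋃π = x∈p∧x∉q⇒x∈p─q (subst (_∈ ⋃π) (⁻¹∙-⁻¹ g h) (⋃π-⁻¹-closed T e∈π x∈⋃π))
                              (g≢h ∘ sym ∘ ⁻¹∙-≡ε⇒≡ h g ∘ x∈⁅y⁆⇒x≡y e)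
      from : (h ⁻¹) ∙ g ∈ S G π → (g ⁻¹) ∙ h ∈ ⋃π
      from x∈S = subst (_∈ ⋃π) (⁻¹∙-⁻¹ h g) (⋃π-⁻¹-closed T e∈π (p─q⊆p ⋃π ⁅ e ⁆ x∈S))

    sum-cells≡A+ℓI : (∀ i → e ∈ π i) → (∀ i j → i ≢ j → π i ∩ π j ≡ ⁅ e ⁆) → TAxiom →
                     ∀ g h → sum (map (λ i → 𝟙 ((g ⁻¹) ∙ h ∈? π i)) (allFin ℓ)) ≡ A G π g h + ℓ * I G g h
    sum-cells≡A+ℓI e∈π π-meet T g h with g ≟ h
    ... | yes refl = begin
      sum (map (λ i → 𝟙 ((g ⁻¹) ∙ g ∈? π i)) (allFin ℓ))
        ≡⟨ cong (λ x → sum (map (λ i → 𝟙 (x ∈? π i)) (allFin ℓ))) (inverseˡ g) ⟩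
      sum (map (λ i → 𝟙 (e ∈? π i)) (allFin ℓ))   ≡⟨ sum-cells-at-identity e∈π ⟩
      ℓ                                            ≡⟨ sym (ℕ.*-identityʳ ℓ) ⟩
      0 + ℓ * 1                                    ≡⟨ cong (_+ ℓ * 1) (sym (𝟙-no e∉S _)) ⟩
      A G π g g + ℓ * 1                            ∎
      where
      e∉S : (g ⁻¹) ∙ g ∉ S G π
      e∉S x∈S = x∈p─q⇒x∉q ⋃π ⁅ e ⁆ x∈S (subst (_∈ ⁅ e ⁆) (sym (inverseˡ g)) (x∈⁅x⁆ e))
    ... | no g≢h = begin
      sum (map (λ i → 𝟙 ((g ⁻¹) ∙ h ∈? π i)) (allFin ℓ))
        ≡⟨ sum-cells-at-non-identity π-meet (g≢h ∘ ⁻¹∙-≡ε⇒≡ g h) ⟩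
      𝟙 ((g ⁻¹) ∙ h ∈? ⋃π)     ≡⟨ 𝟙-cong (quotient-∈-⋃π⇔∈-S T e∈π g≢h) _ _ ⟩
      A G π g h                ≡⟨ sym (ℕ.+-identityʳ _) ⟩
      A G π g h + 0            ≡⟨ cong (A G π g h +_) (sym (ℕ.*-zeroʳ ℓ)) ⟩
      A G π g h + ℓ * 0        ∎

proposition3p1 : (G : FinGroup) → (k ℓ : ℕ) → (π : Fin ℓ → Subset (FinGroup.order G))
    → Injective _≡_ _≡_ π
    → (∀ i → ∣ π i ∣ ≡ k)
    → (∀ i → FinGroup.e G ∈ π i)
    → (∀ i j → i ≢ j → π i ∩ π j ≡ ⁅ FinGroup.e G ⁆)
    → (∀ i s → s ∈ π i → Σ (Fin ℓ) (λ j → translate G (FinGroup._⁻¹ G s) (π i) ≡ π j))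
    → ∀ g h → NNᵀ G π g h ≡ A G π g h + ℓ * I G g h
proposition3p1 G _ ℓ π π-injective _ e∈π π-meet T g h = begin
  NNᵀ G π g h                                               ≡⟨ NNᵀ≡sum-cells G π π-injective e∈π T g h ⟩
  sum (map (λ i → [ G ] ((g ⁻¹) ∙ h ∈? π i)) (allFin ℓ))   ≡⟨ sum-cells≡A+ℓI G π e∈π π-meet T g h ⟩
  A G π g h + ℓ * I G g h                                   ∎
  where open FinGroup G
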